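{- If the starting position of the reversed Zeckendorf game is a multiset of Fibonacci numbers in which every bin has even height (i.e., every Fibonacci number $F_k$ occurs an even number of times), then Player 2 (the player not moving first) has a winning strategy.
   Context: Fibonacci numbers are indexed $F_1=1$, $F_2=2$, $F_{k+1}=F_k+F_{k-1}$. A game state is a multiset of Fibonacci numbers ("chips"); the number of chips equal to $F_k$ is the height $h_k$ of bin $k$. In the reversed Zeckendorf game, two players alternate moves from a given starting state; the legal moves are: (Split) for $k \geq 3$, if $h_k \geq 1$, replace one chip $F_k$ by one chip $F_{k-1}$ and one chip $F_{k-2}$; and if $h_2 \geq 1$, replace one chip $F_2$ by two chips $F_1$. (Combine) for $k > 2$, if $h_{k-2}\ge1$ and $h_{k+1} \geq 1$, replace one chip $F_{k-2}$ and one chip $F_{k+1}$ by two chips $F_k$; and if $h_1 \geq 1$ and $h_3 \geq 1$, replace one chip $F_1$ and one chip $F_3$ by two chips $F_2$. A player who cannot move loses. -}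

module Defs where

open import Data.Nat using (ℕ; zero; suc; _+_; _∸_; _≤_)
open import Data.List using (List; []; _∷_)
open import Data.Product using (Σ; _×_)

-- A game state is given by its list of bin heights:
-- the i-th entry (0-based) is h_{i+1}, the number of chips F_{i+1}.
-- Bins beyond the end of the list have height 0.
-- (No move ever creates a chip in a bin above the largest occupied one,
--  so the length of the list never needs to grow.)
State : Set
State = List ℕ

get : State → ℕ → ℕ
get []       _       = 0
get (x ∷ xs) zero    = x
get (x ∷ xs) (suc i) = get xs i

modify : ℕ → (ℕ → ℕ) → State → State
modify _       f []       = []
modify zero    f (x ∷ xs) = f x ∷ xs
modify (suc i) f (x ∷ xs) = x ∷ modify i f xs

add : ℕ → ℕ → State → State
add i n = modify i (λ x → x + n)

sub : ℕ → ℕ → State → State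
sub i n = modify i (λ x → x ∸ n)

-- Legal moves of the reversed Zeckendorf game (indices below are 0-based,
-- bin k of the paper is index k-1).
data Move (s : State) : State → Set where
  -- Split, k = i+3 ≥ 3: F_k → F_{k-1} + F_{k-2}
  split  : (i : ℕ) → 1 ≤ get s (2 + i) →
           Move s (add i 1 (add (1 + i) 1 (sub (2 + i) 1 s)))
  split2 : 1 ≤ get s 1 → Move s (add 0 2 (sub 1 1 s))
  -- Combine, k = i+3 > 2: F_{k-2} + F_{k+1} → 2 F_k
  combine  : (i : ℕ) → 1 ≤ get s i → 1 ≤ get s (3 + i) →
             Move s (add (2 + i) 2 (sub (3 + i) 1 (sub i 1 s)))
  combine2 : 1 ≤ get s 0 → 1 ≤ get s 2 →
             Move s (add 1 2 (sub 2 1 (sub 0 1 s)))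

-- Winning positions, defined inductively (so wins occur after finitely many
-- moves; the game is finite anyway).
data PlayerToMoveWins (s : State) : Set
data PlayerToMoveLoses (s : State) : Set

data PlayerToMoveWins s where
  win : (t : State) → Move s t → PlayerToMoveLoses t → PlayerToMoveWins s

data PlayerToMoveLoses s where
  lose : ((t : State) → Move s t → PlayerToMoveWins t) → PlayerToMoveLoses s

Player2Wins : State → Set
Player2Wins = PlayerToMoveLoses

{-# OPTIONS --safe #-}
-- Player 2 answers every move by repeating it. From an all-even position the
-- repeated move is legal (a bin that was decremented had even, hence ≥ 2,
-- chips) and the two moves change every bin by an even amount, so Player 2
-- always reaches an all-even position again. The game terminates because
-- every move strictly decreases the weight Σ h_{k+1} 3^k.
module Submission where

open import Defs
open import Data.Nat.Divisibility using (_∣_; ∣⇒≤; ∣m∣n⇒∣m+n; ∣m+n∣m⇒∣n; ∣-refl)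
open import Data.List.Relation.Unary.All using (All; _∷_)
open import Data.Nat using (ℕ; suc; _+_; _*_; _∸_; _≤_; _<_; s≤s; z<s; >-nonZero)
open import Data.Nat.Properties using (+-assoc; ∸-monoˡ-≤; m<m+n; +-monoʳ-<; *-monoʳ-<; <-trans)
open import Data.Nat.Induction using (<-wellFounded)
open import Data.Nat.Tactic.RingSolver using (solve-∀)
open import Data.List using ([]; _∷_)
open import Data.Product using (Σ; _×_; _,_)
open import Induction.WellFounded using (Acc; acc)
open import Relation.Binary.PropositionalEquality using (_≡_; refl; sym; subst)

module _ (Invariant : State → Set) (measure : State → ℕ)
         (measure-decreases : ∀ {s t} → Move s t → measure t < measure s)
         (respond : ∀ {s t} → Invariant s → Move s t → Σ State λ u → Move t u × Invariant u)
  where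

  invariant-acc⇒loses : ∀ {s} → Acc _<_ (measure s) → Invariant s → PlayerToMoveLoses s
  invariant-acc⇒loses {s} (acc rec) inv = lose λ t m → winWith m (respond inv m)
    where
    winWith : ∀ {t} → Move s t → Σ State (λ u → Move t u × Invariant u) → PlayerToMoveWins t
    winWith m (u , m′ , inv′) =
      win u m′ (invariant-acc⇒loses (rec (<-trans (measure-decreases m′) (measure-decreases m))) inv′)

  invariant⇒loses : ∀ s → Invariant s → PlayerToMoveLoses s
  invariant⇒loses s = invariant-acc⇒loses (<-wellFounded (measure s))

even-+2 : ∀ {n} → 2 ∣ n → 2 ∣ n + 2
even-+2 e = ∣m∣n⇒∣m+n e ∣-refl

even-+1+1 : ∀ {n} → 2 ∣ n → 2 ∣ n + 1 + 1
even-+1+1 {n} e = subst (2 ∣_) (sym (+-assoc n 1 1)) (even-+2 e)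

even-∸1∸1 : ∀ {n} → 2 ∣ n → 2 ∣ n ∸ 1 ∸ 1
even-∸1∸1 {0}           e = e
even-∸1∸1 {1}           e with ∣⇒≤ e
... | s≤s ()
even-∸1∸1 {suc (suc n)} e = ∣m+n∣m⇒∣n e ∣-refl

even-pred-positive : ∀ {n} → 2 ∣ n → 1 ≤ n → 1 ≤ n ∸ 1
even-pred-positive e n≥1 = ∸-monoˡ-≤ 1 (∣⇒≤ {{>-nonZero n≥1}} e)

Even : State → Set
Even = All (2 ∣_)

afterSplit : ℕ → State → State
afterSplit i s = add i 1 (add (1 + i) 1 (sub (2 + i) 1 s))

afterSplit₂ : State → State
afterSplit₂ s = add 0 2 (sub 1 1 s)

afterCombine : ℕ → State → State
afterCombine i s = add (2 + i) 2 (sub (3 + i) 1 (sub i 1 s))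

afterCombine₂ : State → State
afterCombine₂ s = add 1 2 (sub 2 1 (sub 0 1 s))

split-repeatable : ∀ i s → Even s → 1 ≤ get s (2 + i) →
                   1 ≤ get (afterSplit i s) (2 + i) × Even (afterSplit i (afterSplit i s))
split-repeatable 0 (a ∷ b ∷ c ∷ r) (ea ∷ eb ∷ ec ∷ er) c≥1 =
  even-pred-positive ec c≥1 , even-+1+1 ea ∷ even-+1+1 eb ∷ even-∸1∸1 ec ∷ er
split-repeatable (suc i) (x ∷ s) (ex ∷ e) h with split-repeatable i s e h
... | h′ , e′ = h′ , ex ∷ e′

split₂-repeatable : ∀ s → Even s → 1 ≤ get s 1 →
                    1 ≤ get (afterSplit₂ s) 1 × Even (afterSplit₂ (afterSplit₂ s))
split₂-repeatable (a ∷ b ∷ r) (ea ∷ eb ∷ er) b≥1 =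
  even-pred-positive eb b≥1 , even-+2 (even-+2 ea) ∷ even-∸1∸1 eb ∷ er

combine-repeatable : ∀ i s → Even s → 1 ≤ get s i → 1 ≤ get s (3 + i) →
                     1 ≤ get (afterCombine i s) i × 1 ≤ get (afterCombine i s) (3 + i) ×
                     Even (afterCombine i (afterCombine i s))
combine-repeatable 0 (a ∷ b ∷ c ∷ d ∷ r) (ea ∷ eb ∷ ec ∷ ed ∷ er) a≥1 d≥1 =
  even-pred-positive ea a≥1 , even-pred-positive ed d≥1 ,
  even-∸1∸1 ea ∷ eb ∷ even-+2 (even-+2 ec) ∷ even-∸1∸1 ed ∷ er
combine-repeatable (suc i) (x ∷ s) (ex ∷ e) h₁ h₂ with combine-repeatable i s e h₁ h₂
... | h₁′ , h₂′ , e′ = h₁′ , h₂′ , ex ∷ e′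

combine₂-repeatable : ∀ s → Even s → 1 ≤ get s 0 → 1 ≤ get s 2 →
                      1 ≤ get (afterCombine₂ s) 0 × 1 ≤ get (afterCombine₂ s) 2 ×
                      Even (afterCombine₂ (afterCombine₂ s))
combine₂-repeatable (a ∷ b ∷ c ∷ r) (ea ∷ eb ∷ ec ∷ er) a≥1 c≥1 =
  even-pred-positive ea a≥1 , even-pred-positive ec c≥1 ,
  even-∸1∸1 ea ∷ even-+2 (even-+2 eb) ∷ even-∸1∸1 ec ∷ er

repeat-move : ∀ {s t} → Even s → Move s t → Σ State λ u → Move t u × Even u
repeat-move {s} e (split i h) with split-repeatable i s e h
... | h′ , e′ = _ , split i h′ , e′
repeat-move {s} e (split2 h) with split₂-repeatable s e h
... | h′ , e′ = _ , split2 h′ , e′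
repeat-move {s} e (combine i h₁ h₂) with combine-repeatable i s e h₁ h₂
... | h₁′ , h₂′ , e′ = _ , combine i h₁′ h₂′ , e′
repeat-move {s} e (combine2 h₁ h₂) with combine₂-repeatable s e h₁ h₂
... | h₁′ , h₂′ , e′ = _ , combine2 h₁′ h₂′ , e′

weight : State → ℕ
weight []       = 0
weight (x ∷ xs) = x + 3 * weight xs

+-suc≡⇒< : ∀ {m n} d → m + suc d ≡ n → m < n
+-suc≡⇒< {m} d refl = m<m+n m z<s

-- Opaque: unfolding these reflection-generated proofs while checking the
-- clauses below is prohibitively slow.
opaque
  split-balance : ∀ a b c w →
    (a + 1) + 3 * ((b + 1) + 3 * (c + 3 * w)) + 5 ≡ a + 3 * (b + 3 * (suc c + 3 * w))
  split-balance = solve-∀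

  split₂-balance : ∀ a b w → (a + 2) + 3 * (b + 3 * w) + 1 ≡ a + 3 * (suc b + 3 * w)
  split₂-balance = solve-∀

  combine-balance : ∀ a b c d w →
    a + 3 * (b + 3 * ((c + 2) + 3 * (d + 3 * w))) + 10 ≡ suc a + 3 * (b + 3 * (c + 3 * (suc d + 3 * w)))
  combine-balance = solve-∀

  combine₂-balance : ∀ a b c w →
    a + 3 * ((b + 2) + 3 * (c + 3 * w)) + 4 ≡ suc a + 3 * (b + 3 * (suc c + 3 * w))
  combine₂-balance = solve-∀

weight-afterSplit-< : ∀ i s → 1 ≤ get s (2 + i) → weight (afterSplit i s) < weight s
weight-afterSplit-< 0       (a ∷ b ∷ suc c ∷ r) _ = +-suc≡⇒< 4 (split-balance a b c (weight r))
weight-afterSplit-< (suc i) (x ∷ s)             h = +-monoʳ-< x (*-monoʳ-< 3 (weight-afterSplit-< i s h))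

weight-afterSplit₂-< : ∀ s → 1 ≤ get s 1 → weight (afterSplit₂ s) < weight s
weight-afterSplit₂-< (a ∷ suc b ∷ r) _ = +-suc≡⇒< 0 (split₂-balance a b (weight r))

weight-afterCombine-< : ∀ i s → 1 ≤ get s i → 1 ≤ get s (3 + i) → weight (afterCombine i s) < weight s
weight-afterCombine-< 0       (suc a ∷ b ∷ c ∷ suc d ∷ r) _ _ =
  +-suc≡⇒< 9 (combine-balance a b c d (weight r))
weight-afterCombine-< (suc i) (x ∷ s) h₁ h₂ =
  +-monoʳ-< x (*-monoʳ-< 3 (weight-afterCombine-< i s h₁ h₂))

weight-afterCombine₂-< : ∀ s → 1 ≤ get s 0 → 1 ≤ get s 2 → weight (afterCombine₂ s) < weight s
weight-afterCombine₂-< (suc a ∷ b ∷ suc c ∷ r) _ _ = +-suc≡⇒< 3 (combine₂-balance a b c (weight r))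

weight-decreases : ∀ {s t} → Move s t → weight t < weight s
weight-decreases {s} (split i h)       = weight-afterSplit-< i s h
weight-decreases {s} (split2 h)        = weight-afterSplit₂-< s h
weight-decreases {s} (combine i h₁ h₂) = weight-afterCombine-< i s h₁ h₂
weight-decreases {s} (combine2 h₁ h₂)  = weight-afterCombine₂-< s h₁ h₂

lemma4p1 : (s : State) → All (2 ∣_) s → Player2Wins s
lemma4p1 = invariant⇒loses Even weight weight-decreases repeat-move
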